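{- Every finite subset of a poset is $\mathrm K$-linked. In particular, Cohen forcing is $\sigma$-$\mathrm K$-linked.
   Context: Let $\mathbb P$ be a poset. For $A\subseteq\mathbb P$, $A^{\not\perp}=\{p\in\mathbb P:\exists q\in A\ p\text{ and }q\text{ are compatible}\}$. For $A,B\subseteq\mathbb P$, $B$ refines $A$ if for every $p\in B$ there is $q\in A$ with $p\le q$. A set $Q\subseteq\mathbb P$ is $\mathrm K$-linked if there is $Q'\subseteq\mathbb P$ such that (a) there is a finite $A\subseteq Q'$ with $Q\subseteq A^{\not\perp}$, and (b) whenever $A\subseteq Q'$ is finite with $Q\subseteq A^{\not\perp}$, then for every open dense $D\subseteq\mathbb P$ there is a finite $B\subseteq D\cap Q'$ such that $B$ refines $A$ and $Q\subseteq B^{\not\perp}$. $\mathbb P$ is $\sigma$-$\mathrm K$-linked if it is a countable union of $\mathrm K$-linked sets. Cohen forcing is $2^{<\omega}$ ordered by reverse inclusion. -}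

module Defs where

open import Level using (Level; _⊔_; suc)
open import Data.Nat using (ℕ)
open import Data.Bool using (Bool)
open import Data.List using (List)
open import Data.List.Relation.Unary.All using (All)
open import Data.List.Relation.Unary.Any using (Any)
open import Data.List.Membership.Propositional using (_∈_)
open import Data.Product using (Σ; ∃; _×_)
open import Relation.Unary using (Pred)
open import Relation.Binary.Bundles using (Poset)
open import Relation.Binary.PropositionalEquality using (_≡_)
import Relation.Binary.PropositionalEquality.Properties as ≡P
import Data.List.Relation.Binary.Pointwise as PW
import Data.List.Relation.Binary.Prefix.Heterogeneous as Pre
import Data.List.Relation.Binary.Prefix.Homogeneous.Properties as PreP
import Relation.Binary.Construct.Flip.EqAndOrd as Flip

module _ {c ℓ₁ ℓ₂ : Level} (P : Poset c ℓ₁ ℓ₂) where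
  open Poset P

  Compatible : Carrier → Carrier → Set (c ⊔ ℓ₂)
  Compatible p q = ∃ λ r → (r ≤ p) × (r ≤ q)

  -- A finite subset A ⊆ P is represented by a list of its elements.
  -- NotPerp A p  :⇔  p ∈ A^{not⊥}
  NotPerp : List Carrier → Carrier → Set (c ⊔ ℓ₂)
  NotPerp A p = Any (λ q → Compatible p q) A

  _⊆NotPerp_ : {q : Level} → Pred Carrier q → List Carrier → Set (c ⊔ ℓ₂ ⊔ q)
  Q ⊆NotPerp A = ∀ p → Q p → NotPerp A p

  Refines : List Carrier → List Carrier → Set (c ⊔ ℓ₂)
  Refines B A = All (λ p → Any (λ q → p ≤ q) A) B

  _⊆ₗ_ : {k : Level} → List Carrier → Pred Carrier k → Set (c ⊔ k)
  A ⊆ₗ X = All X A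

  OpenDense : {k : Level} → Pred Carrier k → Set (c ⊔ ℓ₂ ⊔ k)
  OpenDense D = (∀ p q → D p → q ≤ p → D q) × (∀ p → ∃ λ q → (q ≤ p) × D q)

  Finite : {q : Level} → Pred Carrier q → Set (c ⊔ q)
  Finite Q = ∃ λ (l : List Carrier) → ∀ p → (Q p → p ∈ l) × (p ∈ l → Q p)

  -- K-linked, with Q' and the open dense sets D ranging over subsets of level k
  KLinked : (k : Level) {q : Level} → Pred Carrier q → Set (c ⊔ ℓ₂ ⊔ suc k ⊔ q)
  KLinked k Q = Σ (Pred Carrier k) λ Q' →
      (∃ λ A → (A ⊆ₗ Q') × (Q ⊆NotPerp A))
    × (∀ A → A ⊆ₗ Q' → Q ⊆NotPerp A →
         (D : Pred Carrier k) → OpenDense D →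
         ∃ λ B → (B ⊆ₗ (λ p → D p × Q' p)) × Refines B A × (Q ⊆NotPerp B))

  SigmaKLinked : (k q : Level) → Set (c ⊔ ℓ₂ ⊔ suc k ⊔ suc q)
  SigmaKLinked k q = Σ (ℕ → Pred Carrier q) λ Qn →
    (∀ n → KLinked k (Qn n)) × (∀ p → ∃ λ n → Qn n p)

-- Cohen forcing: 2^{<ω} = finite binary sequences, ordered by reverse
-- inclusion: p ≤ q iff q is an initial segment (prefix) of p.
prefixPoset : Poset Level.zero Level.zero Level.zero
prefixPoset = record
  { Carrier = List Bool
  ; _≈_ = PW.Pointwise _≡_
  ; _≤_ = Pre.Prefix _≡_
  ; isPartialOrder = PreP.isPartialOrder (≡P.isPartialOrder {A = Bool})
  }

Cohen : Poset Level.zero Level.zero Level.zero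
Cohen = Flip.poset prefixPoset

{-# OPTIONS --safe #-}
-- Take Q' to be the whole poset. Given A with Q ⊆ A^{not⊥} and a dense D,
-- each of the finitely many p ∈ Q has a common extension r with some a ∈ A;
-- density gives d ≤ r in D, so d lies below a and is compatible with p.
-- Collecting one such d per p yields B. Cohen forcing is the countable
-- union of the finite sets of binary strings of length n.
module Submission where

open import Defs
open import Level using (Level; _⊔_; Lift; lift)
open import Data.Product using (_×_; _,_; ∃; proj₁; proj₂)
open import Data.Unit.Polymorphic using (⊤)
open import Data.Bool using (Bool; true; false)
open import Data.Nat using (ℕ; zero; suc)
open import Data.List using (List; []; _∷_; length; cartesianProductWith)
open import Data.List.Relation.Unary.All as All using (All; []; _∷_)
open import Data.List.Relation.Unary.Any as Any using (Any; here; there)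
open import Data.List.Membership.Propositional using (_∈_; find; lose)
open import Data.List.Membership.Propositional.Properties
  using (∈-cartesianProductWith⁺; ∈-cartesianProductWith⁻)
open import Relation.Unary using (Pred)
open import Relation.Binary.Bundles using (Poset)
open import Relation.Binary.PropositionalEquality using (_≡_; refl; cong)

collect-witnesses : ∀ {a b s r} {A : Set a} {B : Set b} {S : Pred B s} {R : B → A → Set r}
  {xs : List A} → All (λ x → ∃ λ y → S y × R y x) xs →
  ∃ λ ys → All S ys × All (λ x → Any (λ y → R y x) ys) xs
collect-witnesses []                     = [] , [] , []
collect-witnesses ((y , Sy , Ryx) ∷ wit) =
  let ys , Sys , covered = collect-witnesses wit
  in y ∷ ys , Sy ∷ Sys , here Ryx ∷ All.map there covered

module _ {c ℓ₁ ℓ₂ : Level} (P : Poset c ℓ₁ ℓ₂) where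
  open Poset P using (Carrier; _≤_; trans) renaming (refl to ≤-refl)

  Dense : ∀ {k} → Pred Carrier k → Set (c ⊔ ℓ₂ ⊔ k)
  Dense D = ∀ p → ∃ λ q → (q ≤ p) × D q

  below⇒compatible : ∀ {p q} → q ≤ p → Compatible P p q
  below⇒compatible q≤p = _ , q≤p , ≤-refl

  dense-below-compatible : ∀ {k} {D : Pred Carrier k} {A p} → Dense D → NotPerp P A p →
    ∃ λ d → (D d × Any (d ≤_) A) × d ≤ p
  dense-below-compatible dense p∈A⊥ =
    let a , a∈A , r , r≤p , r≤a = find p∈A⊥
        d , d≤r , Dd = dense r
    in d , (Dd , lose a∈A (trans d≤r r≤a)) , trans d≤r r≤p

  dense-refinement : ∀ {k} {D : Pred Carrier k} {A l} → Dense D → All (NotPerp P A) l →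
    ∃ λ B → All (λ d → D d × Any (d ≤_) A) B × All (NotPerp P B) l
  dense-refinement dense l⊆A⊥ =
    let B , DB , covered = collect-witnesses (All.map (dense-below-compatible dense) l⊆A⊥)
    in B , DB , All.map (Any.map below⇒compatible) covered

  finite⇒KLinked : ∀ {q} k {Q : Pred Carrier q} → Finite P Q → KLinked P k Q
  finite⇒KLinked k {Q} (l , Q⇔l) = (λ _ → ⊤) , (l , All.universal _ l , Q⊆l⊥) , refine
    where
    Q⊆l⊥ : _⊆NotPerp_ P Q l
    Q⊆l⊥ p Qp = Any.map (λ { refl → below⇒compatible ≤-refl }) (proj₁ (Q⇔l p) Qp)

    refine : ∀ A → _⊆ₗ_ P A (λ _ → ⊤) → _⊆NotPerp_ P Q A →
      (D : Pred Carrier k) → OpenDense P D →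
      ∃ λ B → _⊆ₗ_ P B (λ p → D p × ⊤) × Refines P B A × _⊆NotPerp_ P Q B
    refine A _ Q⊆A⊥ D (_ , dense) =
      let l⊆A⊥ = All.tabulate λ p∈l → Q⊆A⊥ _ (proj₂ (Q⇔l _) p∈l)
          B , DB , l⊆B⊥ = dense-refinement dense l⊆A⊥
      in B , All.map (λ (Dd , _) → Dd , _) DB , All.map proj₂ DB ,
         λ p Qp → All.lookup l⊆B⊥ (proj₁ (Q⇔l p) Qp)

  finiteCover⇒σKLinked : ∀ k {q} (Qn : ℕ → Pred Carrier q) →
    (∀ n → Finite P (Qn n)) → (∀ p → ∃ λ n → Qn n p) → SigmaKLinked P k q
  finiteCover⇒σKLinked k Qn finite cover = Qn , (λ n → finite⇒KLinked k (finite n)) , cover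

bitStrings : ℕ → List (List Bool)
bitStrings zero    = [] ∷ []
bitStrings (suc n) = cartesianProductWith _∷_ (false ∷ true ∷ []) (bitStrings n)

∈-bools : ∀ b → b ∈ false ∷ true ∷ []
∈-bools false = here refl
∈-bools true  = there (here refl)

∈-bitStrings⁺ : ∀ p → p ∈ bitStrings (length p)
∈-bitStrings⁺ []      = here refl
∈-bitStrings⁺ (b ∷ p) = ∈-cartesianProductWith⁺ _∷_ (∈-bools b) (∈-bitStrings⁺ p)

∈-bitStrings⁻ : ∀ n {p} → p ∈ bitStrings n → length p ≡ n
∈-bitStrings⁻ zero    (here refl) = refl
∈-bitStrings⁻ (suc n) p∈
  with _ , _ , _ , p′∈ , refl
         ← ∈-cartesianProductWith⁻ _∷_ (false ∷ true ∷ []) (bitStrings n) p∈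
  = cong suc (∈-bitStrings⁻ n p′∈)

ofLength : ∀ q → ℕ → Pred (List Bool) q
ofLength q n p = Lift q (length p ≡ n)

ofLength-finite : ∀ q n → Finite Cohen (ofLength q n)
ofLength-finite q n = bitStrings n , λ p → (λ { (lift refl) → ∈-bitStrings⁺ p }) ,
                                           (λ p∈ → lift (∈-bitStrings⁻ n p∈))

lemma5p12 : ∀ {c ℓ₁ ℓ₂ q k : Level}
    → ((P : Poset c ℓ₁ ℓ₂) (Q : Pred (Poset.Carrier P) q) → Finite P Q → KLinked P k Q)
      × SigmaKLinked Cohen k q
lemma5p12 {q = q} {k} =
  (λ P Q → finite⇒KLinked P k) ,
  finiteCover⇒σKLinked Cohen k (ofLength q) (ofLength-finite q) (λ p → length p , lift refl)
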